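{- Each of the logics $\mathbf{Ł}(I)$, $\mathbf{S4Ł}(I)$, $\mathbf{S4Ł}$ and $\mathbf{S4_tŁ}$ has the local deduction-detachment theorem: there is a family $\{d_j(p,q): j\in J\}$ of sets of formulas in at most two variables such that for every set $\Gamma\cup\{\varphi,\psi\}$ of formulas, $\Gamma,\varphi\vdash_{\mathbf L}\psi$ if and only if $\Gamma\vdash_{\mathbf L} d_j(\varphi,\psi)$ for some $j\in J$.
   Context: $I$ is a set of unary connective symbols disjoint from $\mathcal{L}=\{\wedge,\vee,\cdot,\to,0,1\}$. $\varphi\leftrightarrow\psi$ abbreviates $(\varphi\to\psi)\wedge(\psi\to\varphi)$, $\neg\varphi$ abbreviates $\varphi\to0$. Axiom schemes: (A1) $\varphi\to\varphi$; (A2) $(\varphi\to\psi)\to((\psi\to\chi)\to(\varphi\to\chi))$; (A3) $(\varphi\cdot\psi)\to(\psi\cdot\varphi)$; (A4) $(\varphi\cdot\psi)\to\psi$; (A5) $(\varphi\to(\psi\to\chi))\to((\varphi\cdot\psi)\to\chi)$; (A6) $((\varphi\cdot\psi)\to\chi)\to(\varphi\to(\psi\to\chi))$; (A7) $(\varphi\cdot(\varphi\to\psi))\to(\varphi\wedge\psi)$; (A8) $(\varphi\wedge\psi)\to(\varphi\cdot(\varphi\to\psi))$; (A9) $(\varphi\wedge\psi)\to(\psi\wedge\varphi)$; (A10) $\varphi\to(\varphi\vee\psi)$; (A11) $\psi\to(\varphi\vee\psi)$; (A12) $((\varphi\to\psi)\wedge(\chi\to\psi))\to((\varphi\vee\chi)\to\psi)$;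 (A13) $0\to\varphi$; (A14) $(\varphi\to\psi)\vee(\psi\to\varphi)$; (A15) $\neg\neg\varphi\leftrightarrow\varphi$; for unary $\Box$: (K$_\Box$) $\Box(\varphi\to\psi)\to(\Box\varphi\to\Box\psi)$; (P$_\Box$) $\Box(\varphi\cdot\psi)\leftrightarrow\Box\varphi\cdot\Box\psi$; (M$_\Box$) $\Box(\varphi\wedge\psi)\leftrightarrow\Box\varphi\wedge\Box\psi$; (1$_\Box$) $\Box1\leftrightarrow1$; (0$_\Box$) $\Box0\leftrightarrow0$; (T$_\Box$) $\Box\varphi\to\varphi$; (4$_\Box$) $\Box\varphi\to\Box\Box\varphi$; (GP) $\varphi\to G\neg H\neg\varphi$; (HF) $\varphi\to H\neg G\neg\varphi$. Rules: (MP) $\varphi,\varphi\to\psi\vdash\psi$; ($\Box$-Nec) $\varphi\vdash\Box\varphi$. $\mathbf{Ł}(I)$: language $\mathcal{L}\cup I$, axioms (A1)–(A15) and (K$_\Box$),(P$_\Box$),(M$_\Box$),(1$_\Box$),(0$_\Box$) for all $\Box\in I$, rules (MP) and ($\Box$-Nec) for all $\Box\in I$. $\mathbf{S4Ł}(I)$ adds (T$_\Box$),(4$_\Box$) for all $\Box\in I$; $\mathbf{S4Ł}=\mathbf{S4Ł}(\{\Box\})$; $\mathbf{S4_tŁ}$ is $\mathbf{S4Ł}(\{G,H\})$ plus (GP),(HF). -}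

module Defs where

open import Data.Nat using (ℕ; zero; suc; _≤_)
open import Data.Unit using (⊤)
open import Data.Product using (Σ; _×_; _,_)
open import Data.Sum using (_⊎_)
open import Relation.Binary.PropositionalEquality using (_≡_)

infixr 6 _∧ᶠ_ _∨ᶠ_
infixr 7 _·ᶠ_
infixr 5 _⇒_

data Fm (I : Set) : Set where
  var          : ℕ → Fm I
  _∧ᶠ_ _∨ᶠ_ _·ᶠ_ _⇒_ : Fm I → Fm I → Fm I
  𝟎 𝟏          : Fm I
  □            : I → Fm I → Fm I

module _ {I : Set} where

  infix 4 _⇔ᶠ_
  _⇔ᶠ_ : Fm I → Fm I → Fm I
  φ ⇔ᶠ ψ = (φ ⇒ ψ) ∧ᶠ (ψ ⇒ φ)

  ¬ᶠ : Fm I → Fm I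
  ¬ᶠ φ = φ ⇒ 𝟎

data AxŁ (I : Set) : Fm I → Set where
  A1  : ∀ φ → AxŁ I (φ ⇒ φ)
  A2  : ∀ φ ψ χ → AxŁ I ((φ ⇒ ψ) ⇒ ((ψ ⇒ χ) ⇒ (φ ⇒ χ)))
  A3  : ∀ φ ψ → AxŁ I ((φ ·ᶠ ψ) ⇒ (ψ ·ᶠ φ))
  A4  : ∀ φ ψ → AxŁ I ((φ ·ᶠ ψ) ⇒ ψ)
  A5  : ∀ φ ψ χ → AxŁ I ((φ ⇒ (ψ ⇒ χ)) ⇒ ((φ ·ᶠ ψ) ⇒ χ))
  A6  : ∀ φ ψ χ → AxŁ I (((φ ·ᶠ ψ) ⇒ χ) ⇒ (φ ⇒ (ψ ⇒ χ)))
  A7  : ∀ φ ψ → AxŁ I ((φ ·ᶠ (φ ⇒ ψ)) ⇒ (φ ∧ᶠ ψ))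
  A8  : ∀ φ ψ → AxŁ I ((φ ∧ᶠ ψ) ⇒ (φ ·ᶠ (φ ⇒ ψ)))
  A9  : ∀ φ ψ → AxŁ I ((φ ∧ᶠ ψ) ⇒ (ψ ∧ᶠ φ))
  A10 : ∀ φ ψ → AxŁ I (φ ⇒ (φ ∨ᶠ ψ))
  A11 : ∀ φ ψ → AxŁ I (ψ ⇒ (φ ∨ᶠ ψ))
  A12 : ∀ φ ψ χ → AxŁ I (((φ ⇒ ψ) ∧ᶠ (χ ⇒ ψ)) ⇒ ((φ ∨ᶠ χ) ⇒ ψ))
  A13 : ∀ φ → AxŁ I (𝟎 ⇒ φ)
  A14 : ∀ φ ψ → AxŁ I ((φ ⇒ ψ) ∨ᶠ (ψ ⇒ φ))
  A15 : ∀ φ → AxŁ I ((¬ᶠ (¬ᶠ φ)) ⇔ᶠ φ)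
  K□  : ∀ i φ ψ → AxŁ I (□ i (φ ⇒ ψ) ⇒ (□ i φ ⇒ □ i ψ))
  P□  : ∀ i φ ψ → AxŁ I ((□ i (φ ·ᶠ ψ)) ⇔ᶠ (□ i φ ·ᶠ □ i ψ))
  M□  : ∀ i φ ψ → AxŁ I ((□ i (φ ∧ᶠ ψ)) ⇔ᶠ (□ i φ ∧ᶠ □ i ψ))
  1□  : ∀ i → AxŁ I ((□ i 𝟏) ⇔ᶠ 𝟏)
  0□  : ∀ i → AxŁ I ((□ i 𝟎) ⇔ᶠ 𝟎)

data AxS4Ł (I : Set) : Fm I → Set where
  base : ∀ {φ} → AxŁ I φ → AxS4Ł I φ
  T□   : ∀ i φ → AxS4Ł I (□ i φ ⇒ φ)
  4□   : ∀ i φ → AxS4Ł I (□ i φ ⇒ □ i (□ i φ))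

data GH : Set where
  G H : GH

data AxS4tŁ : Fm GH → Set where
  base : ∀ {φ} → AxS4Ł GH φ → AxS4tŁ φ
  GP   : ∀ φ → AxS4tŁ (φ ⇒ □ G (¬ᶠ (□ H (¬ᶠ φ))))
  HF   : ∀ φ → AxS4tŁ (φ ⇒ □ H (¬ᶠ (□ G (¬ᶠ φ))))

-- Sets of formulas are predicates Fm I → Set.
-- Derivability from a set of premises Γ in the Hilbert calculus with
-- axioms Ax and rules (MP) and (□-Nec) for every □ ∈ I
-- (rules apply to any derived formula, including ones depending on Γ).
data Deriv {I : Set} (Ax : Fm I → Set) (Γ : Fm I → Set) : Fm I → Set where
  assum : ∀ {φ} → Γ φ → Deriv Ax Γ φ
  axiom : ∀ {φ} → Ax φ → Deriv Ax Γ φ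
  mp    : ∀ {φ ψ} → Deriv Ax Γ φ → Deriv Ax Γ (φ ⇒ ψ) → Deriv Ax Γ ψ
  nec   : ∀ (i : I) {φ} → Deriv Ax Γ φ → Deriv Ax Γ (□ i φ)

module _ {I : Set} where

  _,,_ : (Fm I → Set) → Fm I → (Fm I → Set)
  (Γ ,, φ) χ = Γ χ ⊎ (χ ≡ φ)

  DerivSet : (Fm I → Set) → (Fm I → Set) → (Fm I → Set) → Set
  DerivSet Ax Γ Δ = ∀ χ → Δ χ → Deriv Ax Γ χ

  -- formula in at most the two variables p = var 0, q = var 1
  InTwoVars : Fm I → Set
  InTwoVars (var n)  = n ≤ 1
  InTwoVars (φ ∧ᶠ ψ) = InTwoVars φ × InTwoVars ψ
  InTwoVars (φ ∨ᶠ ψ) = InTwoVars φ × InTwoVars ψ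
  InTwoVars (φ ·ᶠ ψ) = InTwoVars φ × InTwoVars ψ
  InTwoVars (φ ⇒ ψ)  = InTwoVars φ × InTwoVars ψ
  InTwoVars 𝟎        = ⊤
  InTwoVars 𝟏        = ⊤
  InTwoVars (□ i φ)  = InTwoVars φ

  subst : (ℕ → Fm I) → Fm I → Fm I
  subst σ (var n)  = σ n
  subst σ (φ ∧ᶠ ψ) = subst σ φ ∧ᶠ subst σ ψ
  subst σ (φ ∨ᶠ ψ) = subst σ φ ∨ᶠ subst σ ψ
  subst σ (φ ·ᶠ ψ) = subst σ φ ·ᶠ subst σ ψ
  subst σ (φ ⇒ ψ)  = subst σ φ ⇒ subst σ ψ
  subst σ 𝟎        = 𝟎
  subst σ 𝟏        = 𝟏
  subst σ (□ i φ)  = □ i (subst σ φ)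

  σ₂ : Fm I → Fm I → ℕ → Fm I
  σ₂ φ ψ zero          = φ
  σ₂ φ ψ (suc zero)    = ψ
  σ₂ φ ψ (suc (suc n)) = var (suc (suc n))

  inst : (Fm I → Set) → Fm I → Fm I → (Fm I → Set)
  inst d φ ψ χ = Σ (Fm I) λ δ → d δ × (χ ≡ subst (σ₂ φ ψ) δ)

  LDDT : (Fm I → Set) → Set₁
  LDDT Ax =
    Σ Set λ J → Σ (J → Fm I → Set) λ d →
      (∀ j δ → d j δ → InTwoVars δ) ×
      (∀ (Γ : Fm I → Set) (φ ψ : Fm I) →
         (Deriv Ax (Γ ,, φ) ψ → Σ J λ j → DerivSet Ax Γ (inst (d j) φ ψ)) ×
         ((Σ J λ j → DerivSet Ax Γ (inst (d j) φ ψ)) → Deriv Ax (Γ ,, φ) ψ))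

-- In any axiomatic extension of Ł(I), a premise φ is used in a derivation
-- only through finitely many boxed copies of it, multiplied by strong
-- conjunction: Γ, φ ⊢ ψ iff Γ ⊢ t(φ) → ψ for some term t built from φ by
-- □ᵢ and ·.  Induction on the derivation gives the term: (MP) multiplies the
-- terms of its two premises and (□ᵢ-Nec) boxes the term, via (K□).  Hence
-- d_t(p, q) = {t(p) → q} witnesses the local deduction-detachment theorem,
-- uniformly for all four logics.
module Submission where

open import Defs
open import Data.Unit using (⊤)
open import Data.Product using (_×_; Σ; _,_)
open import Data.Sum using (inj₁; inj₂)
open import Data.Nat using (z≤n; s≤s)
open import Relation.Binary.PropositionalEquality
  using (_≡_; refl; sym; cong; cong₂) renaming (subst to transport)

Deriv-mono : ∀ {I} {Ax Γ Δ : Fm I → Set} {ψ} →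
             (∀ {χ} → Γ χ → Δ χ) → Deriv Ax Γ ψ → Deriv Ax Δ ψ
Deriv-mono Γ⊆Δ (assum γ)  = assum (Γ⊆Δ γ)
Deriv-mono Γ⊆Δ (axiom a)  = axiom a
Deriv-mono Γ⊆Δ (mp p q)   = mp (Deriv-mono Γ⊆Δ p) (Deriv-mono Γ⊆Δ q)
Deriv-mono Γ⊆Δ (nec i p)  = nec i (Deriv-mono Γ⊆Δ p)

infixl 7 _⊗_

data BoxTerm (I : Set) : Set where
  hyp : BoxTerm I
  box : I → BoxTerm I → BoxTerm I
  _⊗_ : BoxTerm I → BoxTerm I → BoxTerm I

module _ {I : Set} where

  _⟨_⟩ : BoxTerm I → Fm I → Fm I
  hyp     ⟨ φ ⟩ = φ
  box i t ⟨ φ ⟩ = □ i (t ⟨ φ ⟩)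
  (t ⊗ u) ⟨ φ ⟩ = t ⟨ φ ⟩ ·ᶠ u ⟨ φ ⟩

  subst-⟨⟩ : ∀ σ t φ → subst σ (t ⟨ φ ⟩) ≡ t ⟨ subst σ φ ⟩
  subst-⟨⟩ σ hyp       φ = refl
  subst-⟨⟩ σ (box i t) φ = cong (□ i) (subst-⟨⟩ σ t φ)
  subst-⟨⟩ σ (t ⊗ u)   φ = cong₂ _·ᶠ_ (subst-⟨⟩ σ t φ) (subst-⟨⟩ σ u φ)

  InTwoVars-⟨⟩ : ∀ t {φ} → InTwoVars φ → InTwoVars (t ⟨ φ ⟩)
  InTwoVars-⟨⟩ hyp       v = v
  InTwoVars-⟨⟩ (box i t) v = InTwoVars-⟨⟩ t v
  InTwoVars-⟨⟩ (t ⊗ u)   v = InTwoVars-⟨⟩ t v , InTwoVars-⟨⟩ u v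

module AxiomaticExtension {I : Set} (Ax : Fm I → Set)
                          (Ł⊆Ax : ∀ {φ} → AxŁ I φ → Ax φ) where

  infix 3 _⊢_
  _⊢_ : (Fm I → Set) → Fm I → Set
  _⊢_ = Deriv Ax

  module _ {Γ : Fm I → Set} where

    Ł : ∀ {φ} → AxŁ I φ → Γ ⊢ φ
    Ł a = axiom (Ł⊆Ax a)

    ⇒-trans : ∀ {a b c} → Γ ⊢ a ⇒ b → Γ ⊢ b ⇒ c → Γ ⊢ a ⇒ c
    ⇒-trans {a} {b} {c} p q = mp q (mp p (Ł (A2 a b c)))

    curry : ∀ {a b c} → Γ ⊢ (a ·ᶠ b) ⇒ c → Γ ⊢ a ⇒ (b ⇒ c)
    curry {a} {b} {c} p = mp p (Ł (A6 a b c))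

    uncurry : ∀ {a b c} → Γ ⊢ a ⇒ (b ⇒ c) → Γ ⊢ (a ·ᶠ b) ⇒ c
    uncurry {a} {b} {c} p = mp p (Ł (A5 a b c))

    exchange : ∀ {a b c} → Γ ⊢ a ⇒ (b ⇒ c) → Γ ⊢ b ⇒ (a ⇒ c)
    exchange {a} {b} p = curry (⇒-trans (Ł (A3 b a)) (uncurry p))

    ⇒-weaken : ∀ {a b} → Γ ⊢ b → Γ ⊢ a ⇒ b
    ⇒-weaken {a} {b} p = mp p (exchange (curry (Ł (A4 a b))))

    ·-intro : ∀ {a b} → Γ ⊢ a → Γ ⊢ b → Γ ⊢ a ·ᶠ b
    ·-intro {a} {b} p q = mp q (mp p (curry (Ł (A1 (a ·ᶠ b)))))

    ·-mp : ∀ {a b c d} → Γ ⊢ a ⇒ c → Γ ⊢ b ⇒ (c ⇒ d) → Γ ⊢ (a ·ᶠ b) ⇒ d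
    ·-mp p q = uncurry (⇒-trans p (exchange q))

  hyp-⟨⟩ : ∀ {Γ φ} t → (Γ ,, φ) ⊢ t ⟨ φ ⟩
  hyp-⟨⟩ hyp       = assum (inj₂ refl)
  hyp-⟨⟩ (box i t) = nec i (hyp-⟨⟩ t)
  hyp-⟨⟩ (t ⊗ u)   = ·-intro (hyp-⟨⟩ t) (hyp-⟨⟩ u)

  deduction : ∀ {Γ φ ψ} → (Γ ,, φ) ⊢ ψ → Σ (BoxTerm I) λ t → Γ ⊢ t ⟨ φ ⟩ ⇒ ψ
  deduction (assum (inj₁ γ))    = hyp , ⇒-weaken (assum γ)
  deduction (assum (inj₂ refl)) = hyp , Ł (A1 _)
  deduction (axiom a)           = hyp , ⇒-weaken (axiom a)
  deduction (mp p q) with deduction p | deduction q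
  ... | t , t⊢χ | u , u⊢χ⇒ψ = t ⊗ u , ·-mp t⊢χ u⊢χ⇒ψ
  deduction (nec i p) with deduction p
  ... | t , t⊢ψ = box i t , mp (nec i t⊢ψ) (Ł (K□ i _ _))

  detachment : ∀ {Γ φ ψ} t → Γ ⊢ t ⟨ φ ⟩ ⇒ ψ → (Γ ,, φ) ⊢ ψ
  detachment t p = mp (hyp-⟨⟩ t) (Deriv-mono inj₁ p)

  ddt : BoxTerm I → Fm I
  ddt t = t ⟨ var 0 ⟩ ⇒ var 1

  subst-ddt : ∀ t φ ψ → subst (σ₂ φ ψ) (ddt t) ≡ t ⟨ φ ⟩ ⇒ ψ
  subst-ddt t φ ψ = cong (_⇒ ψ) (subst-⟨⟩ (σ₂ φ ψ) t (var 0))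

  lddt : LDDT Ax
  lddt = BoxTerm I , d , d-InTwoVars , λ Γ φ ψ → ⇒-direction , ⇐-direction
    where
    d : BoxTerm I → Fm I → Set
    d t δ = δ ≡ ddt t

    d-InTwoVars : ∀ t δ → d t δ → InTwoVars δ
    d-InTwoVars t δ refl = InTwoVars-⟨⟩ t z≤n , s≤s z≤n

    ⇒-direction : ∀ {Γ φ ψ} → (Γ ,, φ) ⊢ ψ →
                  Σ (BoxTerm I) λ t → DerivSet Ax Γ (inst (d t) φ ψ)
    ⇒-direction {φ = φ} {ψ} p with deduction p
    ... | t , q = t , λ { χ (δ , refl , refl) →
                          transport (Deriv Ax _) (sym (subst-ddt t φ ψ)) q }

    ⇐-direction : ∀ {Γ φ ψ} → (Σ (BoxTerm I) λ t → DerivSet Ax Γ (inst (d t) φ ψ)) →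
                  (Γ ,, φ) ⊢ ψ
    ⇐-direction {φ = φ} {ψ} (t , Γ⊢d) =
      detachment t (transport (Deriv Ax _) (subst-ddt t φ ψ) (Γ⊢d _ (ddt t , refl , refl)))

corollary3 : ((I : Set) → LDDT (AxŁ I) × LDDT (AxS4Ł I)) × LDDT (AxS4Ł ⊤) × LDDT AxS4tŁ
corollary3 = (λ I → AxiomaticExtension.lddt _ (λ a → a) , AxiomaticExtension.lddt _ base)
           , AxiomaticExtension.lddt _ base
           , AxiomaticExtension.lddt _ (λ a → base (base a))
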